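{- For $n\ge 0$ let $S_n$ be the set of binary sequences of length $n$ containing no maximal run of zeros whose length is congruent to $1$ modulo $3$. Classify each nonempty $\mathbf v\in S_n$ into exactly one type: (A) $\mathbf v$ ends in a maximal run of $m>0$ zeros with $m\equiv 0 \pmod 3$; (B) $\mathbf v$ ends in a maximal run of $m>0$ zeros with $m\equiv 2\pmod 3$; (C) $\mathbf v$ ends in a $1$ immediately preceded by a maximal run of $m>0$ zeros with $m\equiv 0\pmod 3$, or $\mathbf v$ is the sequence $1$ of length one; (D) $\mathbf v$ ends in a $1$ immediately preceded by a maximal run of $m>0$ zeros with $m\equiv 2\pmod 3$; (E) $\mathbf v$ ends in $11$. For $n\ge1$ define $f_n:S_n\to\mathcal P(S_{n+1})$ (the power set of $S_{n+1}$) by: $f_n(\mathbf v)=\{\mathbf v1\}$ if $\mathbf v$ has type A or D; $f_n(\mathbf v)=\{\mathbf v0,\mathbf v1\}$ if $\mathbf v$ has type B; and $f_n(\mathbf v)=\{\mathbf v1,\mathbf v'00\}$ if $\mathbf v$ has type C or E, where $\mathbf v'$ is $\mathbf v$ with its last symbol (a $1$) removed. Then for every $n\ge1$, $S_{n+1}$ is the disjoint union $$S_{n+1}=\bigsqcup_{\mathbf v\in S_n} f_n(\mathbf v),\qquad\text{and hence}\qquad |S_{n+1}|=\sum_{\mathbf v\in S_n}|f_n(\mathbf v)|.$$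
   Context: Here a "run of zeros" means a maximal block of consecutive zeros; e.g. $00000\in S_5$ since its only run has length $5\equiv 2\pmod 3$. -}

module Defs where

open import Data.Bool using (Bool; true; false)
open import Data.Nat using (ℕ; zero; suc; _<_; _%_)
open import Data.List using (List; []; _∷_; _++_; [_]; length; reverse)
open import Data.List.Relation.Unary.All using (All)
open import Data.Product using (Σ; ∃; _×_)
open import Data.Sum using (_⊎_)
open import Relation.Binary.PropositionalEquality using (_≡_; _≢_)

-- Binary sequences: lists of Bool, with false = 0 and true = 1.
-- Appending a symbol at the end: v ++ [ b ].

-- Lengths of the maximal runs of zeros, left to right.
-- runsAux k xs : k = length of the zero run currently being read.
flush : ℕ → List ℕ → List ℕ
flush zero    rs = rs
flush (suc k) rs = suc k ∷ rs

runsAux : ℕ → List Bool → List ℕ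
runsAux k []           = flush k []
runsAux k (false ∷ xs) = runsAux (suc k) xs
runsAux k (true  ∷ xs) = flush k (runsAux 0 xs)

zeroRuns : List Bool → List ℕ
zeroRuns = runsAux 0

S : ℕ → List Bool → Set
S n v = length v ≡ n × All (λ m → m % 3 ≢ 1) (zeroRuns v)

leadZ : List Bool → ℕ
leadZ []           = 0
leadZ (false ∷ xs) = suc (leadZ xs)
leadZ (true  ∷ xs) = 0

trailZ : List Bool → ℕ
trailZ v = leadZ (reverse v)

TypeA : List Bool → Set
TypeA v = 0 < trailZ v × trailZ v % 3 ≡ 0

TypeB : List Bool → Set
TypeB v = 0 < trailZ v × trailZ v % 3 ≡ 2

TypeC : List Bool → Set
TypeC v = (∃ λ u → v ≡ u ++ [ true ] × 0 < trailZ u × trailZ u % 3 ≡ 0)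
        ⊎ v ≡ [ true ]

TypeD : List Bool → Set
TypeD v = ∃ λ u → v ≡ u ++ [ true ] × 0 < trailZ u × trailZ u % 3 ≡ 2

TypeE : List Bool → Set
TypeE v = ∃ λ u → v ≡ u ++ (true ∷ true ∷ [])

-- Membership in f_n(v):  InF v w  means  w ∈ f_n(v).
InF : List Bool → List Bool → Set
InF v w =
    ((TypeA v ⊎ TypeD v) × w ≡ v ++ [ true ])
  ⊎ (TypeB v × (w ≡ v ++ [ false ] ⊎ w ≡ v ++ [ true ]))
  ⊎ (∃ λ v' → (TypeC v ⊎ TypeE v) × v ≡ v' ++ [ true ]
              × (w ≡ v ++ [ true ] ⊎ w ≡ v' ++ (false ∷ false ∷ [])))

-- Appending a 1 never changes the list of zero runs of a word, and appending a 0 only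
-- lengthens its final run; so membership in S is governed by the earlier (closed) runs
-- together with the residue mod 3 of the final run.  Hence every w in S (n+1) has exactly
-- one parent: w = x1 comes from x; w = x0 comes from x when the final run of x is ≡ 2, and
-- from v'1 with w = v'00 when it is ≡ 1 (the case ≡ 0 would give w a final run ≡ 1).  The
-- five types only record which of these three edges leave v, and every nonempty v in S
-- has one of them.
module Submission where

open import Defs
open import Data.Bool using (Bool; true; false)
open import Data.Nat using (ℕ; zero; suc; _≤_; _<_; _%_; z≤n; s≤s)
open import Data.Nat.Properties using (+-comm; suc-injective)
open import Data.Nat.DivMod using (%-distribˡ-+; m%n<n)
open import Data.List using (List; []; _∷_; _++_; [_]; length; _∷ʳ_)
open import Data.List.Properties using (length-++; ++-assoc; reverse-++; ∷ʳ-injectiveˡ; ∷ʳ-injectiveʳ)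
open import Data.List.Reverse using (Reverse; reverseView; []; _∶_∶ʳ_)
open import Data.List.Relation.Unary.All using (All; []; _∷_)
open import Data.List.Relation.Unary.All.Properties using (++⁺; ++⁻)
open import Data.Product using (∃; _×_; _,_; proj₂)
open import Data.Sum using (_⊎_; inj₁; inj₂)
open import Data.Empty using (⊥-elim)
open import Relation.Nullary using (contradiction)
open import Relation.Binary.PropositionalEquality
  using (_≡_; _≢_; refl; sym; trans; cong; subst; module ≡-Reasoning)

suc-%3 : ∀ t {r} → t % 3 ≡ r → suc t % 3 ≡ suc r % 3
suc-%3 t eq = trans (%-distribˡ-+ 1 t 3) (cong (λ r → suc r % 3) eq)

%3-trichotomy : ∀ t → t % 3 ≡ 0 ⊎ t % 3 ≡ 1 ⊎ t % 3 ≡ 2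
%3-trichotomy t with t % 3 | m%n<n t 3
... | 0 | _ = inj₁ refl
... | 1 | _ = inj₂ (inj₁ refl)
... | 2 | _ = inj₂ (inj₂ refl)
... | suc (suc (suc _)) | s≤s (s≤s (s≤s ()))

%3≡2⇒0< : ∀ t → t % 3 ≡ 2 → 0 < t
%3≡2⇒0< (suc t) _ = s≤s z≤n

suc-%3≡1⇒%3≡0 : ∀ t → suc t % 3 ≡ 1 → t % 3 ≡ 0
suc-%3≡1⇒%3≡0 t eq with %3-trichotomy t
... | inj₁ r0 = r0
... | inj₂ (inj₁ r1) = contradiction (trans (sym (suc-%3 t r1)) eq) λ ()
... | inj₂ (inj₂ r2) = contradiction (trans (sym (suc-%3 t r2)) eq) λ ()

Admissible : ℕ → Set
Admissible m = m % 3 ≢ 1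

admissible-by-residue : ∀ t {r} → t % 3 ≡ r → r ≢ 1 → Admissible t
admissible-by-residue _ eq r≢1 eq′ = r≢1 (trans (sym eq) eq′)

admissible-residue : ∀ t → Admissible t → t % 3 ≡ 0 ⊎ t % 3 ≡ 2
admissible-residue t adm with %3-trichotomy t
... | inj₁ r0 = inj₁ r0
... | inj₂ (inj₁ r1) = contradiction r1 adm
... | inj₂ (inj₂ r2) = inj₂ r2

pending : ℕ → List Bool → ℕ
pending k []           = k
pending k (false ∷ xs) = pending (suc k) xs
pending k (true  ∷ xs) = pending 0 xs

closed : ℕ → List Bool → List ℕ
closed k []           = []
closed k (false ∷ xs) = closed (suc k) xs
closed k (true  ∷ xs) = flush k (closed 0 xs)

closedRuns : List Bool → List ℕ
closedRuns = closed 0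

flush-++ : ∀ k xs ys → flush k (xs ++ ys) ≡ flush k xs ++ ys
flush-++ zero    _ _ = refl
flush-++ (suc k) _ _ = refl

runsAux≡closed++flush : ∀ k xs → runsAux k xs ≡ closed k xs ++ flush (pending k xs) []
runsAux≡closed++flush k []           = refl
runsAux≡closed++flush k (false ∷ xs) = runsAux≡closed++flush (suc k) xs
runsAux≡closed++flush k (true  ∷ xs) =
  trans (cong (flush k) (runsAux≡closed++flush 0 xs)) (flush-++ k _ _)

runsAux-∷ʳ-true : ∀ k xs → runsAux k (xs ∷ʳ true) ≡ runsAux k xs
runsAux-∷ʳ-true k []           = refl
runsAux-∷ʳ-true k (false ∷ xs) = runsAux-∷ʳ-true (suc k) xs
runsAux-∷ʳ-true k (true  ∷ xs) = cong (flush k) (runsAux-∷ʳ-true 0 xs)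

closed-∷ʳ-false : ∀ k xs → closed k (xs ∷ʳ false) ≡ closed k xs
closed-∷ʳ-false k []           = refl
closed-∷ʳ-false k (false ∷ xs) = closed-∷ʳ-false (suc k) xs
closed-∷ʳ-false k (true  ∷ xs) = cong (flush k) (closed-∷ʳ-false 0 xs)

pending-∷ʳ-true : ∀ k xs → pending k (xs ∷ʳ true) ≡ 0
pending-∷ʳ-true k []           = refl
pending-∷ʳ-true k (false ∷ xs) = pending-∷ʳ-true (suc k) xs
pending-∷ʳ-true k (true  ∷ xs) = pending-∷ʳ-true 0 xs

pending-∷ʳ-false : ∀ k xs → pending k (xs ∷ʳ false) ≡ suc (pending k xs)
pending-∷ʳ-false k []           = refl
pending-∷ʳ-false k (false ∷ xs) = pending-∷ʳ-false (suc k) xs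
pending-∷ʳ-false k (true  ∷ xs) = pending-∷ʳ-false 0 xs

trailZ-∷ʳ-true : ∀ xs → trailZ (xs ∷ʳ true) ≡ 0
trailZ-∷ʳ-true xs = cong leadZ (reverse-++ xs [ true ])

trailZ-∷ʳ-false : ∀ xs → trailZ (xs ∷ʳ false) ≡ suc (trailZ xs)
trailZ-∷ʳ-false xs = cong leadZ (reverse-++ xs [ false ])

trailZ-∷ʳ-false-%3 : ∀ xs {r} → trailZ xs % 3 ≡ r → trailZ (xs ∷ʳ false) % 3 ≡ suc r % 3
trailZ-∷ʳ-false-%3 xs eq = trans (cong (_% 3) (trailZ-∷ʳ-false xs)) (suc-%3 (trailZ xs) eq)

pending≡trailZ : ∀ xs → pending 0 xs ≡ trailZ xs
pending≡trailZ xs = go (reverseView xs)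
  where
  open ≡-Reasoning
  go : ∀ {xs} → Reverse xs → pending 0 xs ≡ trailZ xs
  go [] = refl
  go (ys ∶ _ ∶ʳ true) = trans (pending-∷ʳ-true 0 ys) (sym (trailZ-∷ʳ-true ys))
  go (ys ∶ rys ∶ʳ false) = begin
    pending 0 (ys ∷ʳ false) ≡⟨ pending-∷ʳ-false 0 ys ⟩
    suc (pending 0 ys)      ≡⟨ cong suc (go rys) ⟩
    suc (trailZ ys)         ≡⟨ sym (trailZ-∷ʳ-false ys) ⟩
    trailZ (ys ∷ʳ false)    ∎

zeroRuns≡closedRuns++flush : ∀ xs → zeroRuns xs ≡ closedRuns xs ++ flush (trailZ xs) []
zeroRuns≡closedRuns++flush xs =
  trans (runsAux≡closed++flush 0 xs) (cong (λ t → closedRuns xs ++ flush t []) (pending≡trailZ xs))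

length-∷ʳ : ∀ (xs : List Bool) b → length (xs ∷ʳ b) ≡ suc (length xs)
length-∷ʳ xs b = trans (length-++ xs) (+-comm (length xs) 1)

Good : List Bool → Set
Good v = All Admissible (zeroRuns v)

Good-split : ∀ v → Good v → All Admissible (closedRuns v) × Admissible (trailZ v)
Good-split v g with ++⁻ (closedRuns v) (subst (All Admissible) (zeroRuns≡closedRuns++flush v) g)
... | closedOk , finalOk = closedOk , final (trailZ v) finalOk
  where
  final : ∀ t → All Admissible (flush t []) → Admissible t
  final zero    _        = λ ()
  final (suc t) (a ∷ []) = a

Good⇒Admissible-trailZ : ∀ v → Good v → Admissible (trailZ v)
Good⇒Admissible-trailZ v g = proj₂ (Good-split v g)

Good-retrail : ∀ v w → closedRuns w ≡ closedRuns v → Good v → Admissible (trailZ w) → Good w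
Good-retrail v w eq g adm with Good-split v g
... | closedOk , _ = subst (All Admissible) (sym (zeroRuns≡closedRuns++flush w))
                       (++⁺ (subst (All Admissible) (sym eq) closedOk) (final (trailZ w) adm))
  where
  final : ∀ t → Admissible t → All Admissible (flush t [])
  final zero    _ = []
  final (suc t) a = a ∷ []

Good-∷ʳ-true⁺ : ∀ v → Good v → Good (v ∷ʳ true)
Good-∷ʳ-true⁺ v = subst (All Admissible) (sym (runsAux-∷ʳ-true 0 v))

Good-∷ʳ-true⁻ : ∀ v → Good (v ∷ʳ true) → Good v
Good-∷ʳ-true⁻ v = subst (All Admissible) (runsAux-∷ʳ-true 0 v)

data Child (v w : List Bool) : Set where
  add-one  : w ≡ v ∷ʳ true → Child v w
  add-zero : trailZ v % 3 ≡ 2 → w ≡ v ∷ʳ false → Child v w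
  swap-one : ∀ u → v ≡ u ∷ʳ true → trailZ u % 3 ≡ 0 → w ≡ u ∷ʳ false ∷ʳ false → Child v w

Child-length : ∀ {v w} → Child v w → length w ≡ suc (length v)
Child-length {v} (add-one refl)    = length-∷ʳ v true
Child-length {v} (add-zero _ refl) = length-∷ʳ v false
Child-length (swap-one u refl _ refl) = begin
  length (u ∷ʳ false ∷ʳ false) ≡⟨ length-∷ʳ (u ∷ʳ false) false ⟩
  suc (length (u ∷ʳ false))    ≡⟨ cong suc (length-∷ʳ u false) ⟩
  suc (suc (length u))         ≡⟨ cong suc (sym (length-∷ʳ u true)) ⟩
  suc (length (u ∷ʳ true))     ∎
  where open ≡-Reasoning

Child-Good : ∀ {v w} → Good v → Child v w → Good w
Child-Good {v} g (add-one refl) = Good-∷ʳ-true⁺ v g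
Child-Good {v} g (add-zero r2 refl) =
  Good-retrail v (v ∷ʳ false) (closed-∷ʳ-false 0 v) g
    (admissible-by-residue (trailZ (v ∷ʳ false)) (trailZ-∷ʳ-false-%3 v r2) λ ())
Child-Good g (swap-one u refl r0 refl) =
  Good-retrail u (u ∷ʳ false ∷ʳ false) (trans (closed-∷ʳ-false 0 (u ∷ʳ false)) (closed-∷ʳ-false 0 u))
    (Good-∷ʳ-true⁻ u g)
    (admissible-by-residue (trailZ (u ∷ʳ false ∷ʳ false))
      (trailZ-∷ʳ-false-%3 (u ∷ʳ false) (trailZ-∷ʳ-false-%3 u r0)) λ ())

∷ʳ-true≢∷ʳ-false : ∀ (xs ys : List Bool) → xs ∷ʳ true ≢ ys ∷ʳ false
∷ʳ-true≢∷ʳ-false xs ys eq = contradiction (∷ʳ-injectiveʳ xs ys eq) λ ()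

-- The type-B edge and the swap edge into the same word would force the final run of v₁ to
-- be ≡ 2 and ≡ 1 at once.
Child-functional : ∀ {v₁ v₂ w} → Child v₁ w → Child v₂ w → v₁ ≡ v₂
Child-functional (add-one refl) (add-one e) = ∷ʳ-injectiveˡ _ _ e
Child-functional (add-one refl) (add-zero _ e) = ⊥-elim (∷ʳ-true≢∷ʳ-false _ _ e)
Child-functional (add-one refl) (swap-one _ _ _ e) = ⊥-elim (∷ʳ-true≢∷ʳ-false _ _ e)
Child-functional (add-zero _ refl) (add-one e) = ⊥-elim (∷ʳ-true≢∷ʳ-false _ _ (sym e))
Child-functional (add-zero _ refl) (add-zero _ e) = ∷ʳ-injectiveˡ _ _ e
Child-functional (add-zero r2 refl) (swap-one u _ r0 e) with ∷ʳ-injectiveˡ _ _ e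
... | refl = contradiction (trans (sym (trailZ-∷ʳ-false-%3 u r0)) r2) λ ()
Child-functional (swap-one _ _ _ refl) (add-one e) = ⊥-elim (∷ʳ-true≢∷ʳ-false _ _ (sym e))
Child-functional (swap-one u _ r0 refl) (add-zero r2 e) with ∷ʳ-injectiveˡ _ _ e
... | refl = contradiction (trans (sym (trailZ-∷ʳ-false-%3 u r0)) r2) λ ()
Child-functional (swap-one _ refl _ refl) (swap-one _ refl _ e) =
  cong (_∷ʳ true) (∷ʳ-injectiveˡ _ _ (∷ʳ-injectiveˡ _ _ e))

parent-∷ʳ-false : ∀ x → Good (x ∷ʳ false) → ∃ λ v → Good v × Child v (x ∷ʳ false)
parent-∷ʳ-false x g with %3-trichotomy (trailZ x) | Good⇒Admissible-trailZ (x ∷ʳ false) g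
... | inj₁ r0 | adm = contradiction (trailZ-∷ʳ-false-%3 x r0) adm
... | inj₂ (inj₂ r2) | _ =
  x , Good-retrail (x ∷ʳ false) x (sym (closed-∷ʳ-false 0 x)) g
        (admissible-by-residue (trailZ x) r2 λ ()) ,
  add-zero r2 refl
... | inj₂ (inj₁ r1) | _ with reverseView x
...   | [] = contradiction r1 λ ()
...   | y ∶ _ ∶ʳ true  = contradiction (trans (sym (cong (_% 3) (trailZ-∷ʳ-true y))) r1) λ ()
...   | y ∶ _ ∶ʳ false =
  y ∷ʳ true , Good-∷ʳ-true⁺ y good-y , swap-one y refl r0 refl
  where
  r0 : trailZ y % 3 ≡ 0
  r0 = suc-%3≡1⇒%3≡0 (trailZ y) (trans (sym (cong (_% 3) (trailZ-∷ʳ-false y))) r1)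
  closedRuns-y00 : closedRuns y ≡ closedRuns (y ∷ʳ false ∷ʳ false)
  closedRuns-y00 = sym (trans (closed-∷ʳ-false 0 (y ∷ʳ false)) (closed-∷ʳ-false 0 y))
  good-y : Good y
  good-y = Good-retrail (y ∷ʳ false ∷ʳ false) y closedRuns-y00 g
             (admissible-by-residue (trailZ y) r0 λ ())

parent-exists : ∀ w → 0 < length w → Good w → ∃ λ v → Good v × Child v w
parent-exists w nonempty g with reverseView w
... | [] with () ← nonempty
... | x ∶ _ ∶ʳ true  = x , Good-∷ʳ-true⁻ x g , add-one refl
... | x ∶ _ ∶ʳ false = parent-∷ʳ-false x g

0<trailZ-∷ʳ-false : ∀ xs → 0 < trailZ (xs ∷ʳ false)
0<trailZ-∷ʳ-false xs = subst (0 <_) (sym (trailZ-∷ʳ-false xs)) (s≤s z≤n)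

TypeC⊎TypeE-∷ʳ-true : ∀ u → trailZ u % 3 ≡ 0 → TypeC (u ∷ʳ true) ⊎ TypeE (u ∷ʳ true)
TypeC⊎TypeE-∷ʳ-true u r0 with reverseView u
... | [] = inj₁ (inj₂ refl)
... | z ∶ _ ∶ʳ true  = inj₂ (z , ++-assoc z [ true ] [ true ])
... | z ∶ _ ∶ʳ false = inj₁ (inj₁ (z ∷ʳ false , refl , 0<trailZ-∷ʳ-false z , r0))

TypeC⊎TypeE⇒trailZ%3≡0 : ∀ {v u} → TypeC v ⊎ TypeE v → v ≡ u ∷ʳ true → trailZ u % 3 ≡ 0
TypeC⊎TypeE⇒trailZ%3≡0 (inj₁ (inj₁ (_ , refl , _ , r0))) e with ∷ʳ-injectiveˡ _ _ e
... | refl = r0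
TypeC⊎TypeE⇒trailZ%3≡0 (inj₁ (inj₂ refl)) e with ∷ʳ-injectiveˡ [] _ e
... | refl = refl
TypeC⊎TypeE⇒trailZ%3≡0 {u = u} (inj₂ (z , refl)) e
  with ∷ʳ-injectiveˡ (z ∷ʳ true) u (trans (++-assoc z [ true ] [ true ]) e)
... | refl = cong (_% 3) (trailZ-∷ʳ-true z)

InF⇒Child : ∀ {v w} → InF v w → Child v w
InF⇒Child (inj₁ (_ , e))                    = add-one e
InF⇒Child (inj₂ (inj₁ ((_ , r2) , inj₁ e)))  = add-zero r2 e
InF⇒Child (inj₂ (inj₁ (_ , inj₂ e)))         = add-one e
InF⇒Child (inj₂ (inj₂ (_ , _ , _ , inj₁ e))) = add-one e
InF⇒Child (inj₂ (inj₂ (u , ty , ev , inj₂ e))) =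
  swap-one u ev (TypeC⊎TypeE⇒trailZ%3≡0 ty ev) (trans e (sym (++-assoc u [ false ] [ false ])))

InF-∷ʳ-true : ∀ v → 0 < length v → Good v → InF v (v ∷ʳ true)
InF-∷ʳ-true v nonempty g with reverseView v
... | [] with () ← nonempty
... | u ∶ _ ∶ʳ false
  with admissible-residue (trailZ (u ∷ʳ false)) (Good⇒Admissible-trailZ (u ∷ʳ false) g)
...   | inj₁ r0 = inj₁ (inj₁ (0<trailZ-∷ʳ-false u , r0) , refl)
...   | inj₂ r2 = inj₂ (inj₁ ((0<trailZ-∷ʳ-false u , r2) , inj₂ refl))
InF-∷ʳ-true v nonempty g | u ∶ _ ∶ʳ true
  with admissible-residue (trailZ u) (Good⇒Admissible-trailZ u (Good-∷ʳ-true⁻ u g))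
...   | inj₁ r0 = inj₂ (inj₂ (u , TypeC⊎TypeE-∷ʳ-true u r0 , refl , inj₁ refl))
...   | inj₂ r2 = inj₁ (inj₂ (u , refl , %3≡2⇒0< (trailZ u) r2 , r2) , refl)

Child⇒InF : ∀ {v w} → 0 < length v → Good v → Child v w → InF v w
Child⇒InF nonempty g (add-one refl) = InF-∷ʳ-true _ nonempty g
Child⇒InF {v} _ _ (add-zero r2 refl) = inj₂ (inj₁ ((%3≡2⇒0< (trailZ v) r2 , r2) , inj₁ refl))
Child⇒InF _ _ (swap-one u refl r0 refl) =
  inj₂ (inj₂ (u , TypeC⊎TypeE-∷ʳ-true u r0 , refl , inj₂ (++-assoc u [ false ] [ false ])))

lemma1 : ∀ (n : ℕ) → 1 ≤ n →
    ((v : List Bool) → S n v → (w : List Bool) → InF v w → S (suc n) w)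
    × ((w : List Bool) → S (suc n) w →
        ∃ λ v → S n v × InF v w
              × ((v₂ : List Bool) → S n v₂ → InF v₂ w → v₂ ≡ v))
lemma1 n 1≤n = sound , complete
  where
  sound : (v : List Bool) → S n v → (w : List Bool) → InF v w → S (suc n) w
  sound v (len , g) w i = trans (Child-length c) (cong suc len) , Child-Good g c
    where c = InF⇒Child i

  complete : (w : List Bool) → S (suc n) w →
             ∃ λ v → S n v × InF v w × ((v₂ : List Bool) → S n v₂ → InF v₂ w → v₂ ≡ v)
  complete w (len , g) with parent-exists w (subst (0 <_) (sym len) (s≤s z≤n)) g
  ... | v , gv , c =
    v , (lenv , gv) , Child⇒InF (subst (0 <_) (sym lenv) 1≤n) gv c ,
    λ v₂ _ i → Child-functional (InF⇒Child i) c
    where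
    lenv : length v ≡ n
    lenv = suc-injective (trans (sym (Child-length c)) len)
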